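{- Let $n\ge 3$ be an integer and let $G$ be a graph with $\chi(G)=\omega(G)$. Then $G$ is $K_n$-WORM colorable if and only if $\omega(G)\le (n-1)^2$.
   Context: All graphs are finite and simple; $\chi$ is the chromatic number and $\omega$ the clique number. A $K_n$-WORM coloring of $G$ is an assignment of colors to the vertices of $G$ such that no subgraph isomorphic to the complete graph $K_n$ is monochromatic (all its vertices have the same color) or rainbow (its vertices have pairwise distinct colors); $G$ is $K_n$-WORM colorable if it admits such a coloring. -}

module Defs where

open import Level using (0ℓ)
open import Data.Nat using (ℕ; _≤_)
open import Data.Fin using (Fin)
open import Data.Product using (Σ; ∃; _×_)
open import Relation.Nullary using (¬_)
open import Relation.Binary.PropositionalEquality using (_≡_)

record Graph (V : ℕ) : Set₁ where
  field
    Adj   : Fin V → Fin V → Set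
    sym   : ∀ {x y} → Adj x y → Adj y x
    irrefl : ∀ {x} → ¬ Adj x x
open Graph public

record Clique {V : ℕ} (G : Graph V) (k : ℕ) : Set where
  field
    vert  : Fin k → Fin V
    inj   : ∀ i j → vert i ≡ vert j → i ≡ j
    adj   : ∀ i j → ¬ i ≡ j → Adj G (vert i) (vert j)
open Clique public

ProperColoring : {V : ℕ} → Graph V → ℕ → Set
ProperColoring {V} G k =
  Σ (Fin V → Fin k) λ c → ∀ x y → Adj G x y → ¬ c x ≡ c y

IsChromaticNumber : {V : ℕ} → Graph V → ℕ → Set
IsChromaticNumber G k =
  ProperColoring G k × (∀ m → ProperColoring G m → k ≤ m)

IsCliqueNumber : {V : ℕ} → Graph V → ℕ → Set
IsCliqueNumber G k =
  Clique G k × (∀ m → Clique G m → m ≤ k)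

Monochromatic : {V n : ℕ} {G : Graph V} → (Fin V → ℕ) → Clique G n → Set
Monochromatic c K = ∀ i j → c (vert K i) ≡ c (vert K j)

Rainbow : {V n : ℕ} {G : Graph V} → (Fin V → ℕ) → Clique G n → Set
Rainbow c K = ∀ i j → c (vert K i) ≡ c (vert K j) → i ≡ j

-- K_n-WORM coloring: no copy of K_n is monochromatic or rainbow.
-- Colors are natural numbers (arbitrary number of colors).
IsKnWORMColoring : {V : ℕ} → (n : ℕ) → (G : Graph V) → (Fin V → ℕ) → Set
IsKnWORMColoring n G c =
  ∀ (K : Clique G n) → ¬ Monochromatic c K × ¬ Rainbow c K

KnWORMColorable : {V : ℕ} → ℕ → Graph V → Set
KnWORMColorable n G = ∃ λ c → IsKnWORMColoring n G c

module Submission where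

-- (⇒) An Erdős–Szekeres-type selection lemma: among more than m·b objects
--     coloured by natural numbers there are m+1 objects of pairwise
--     distinct colours or b+1 objects of one colour. Applied with m = b = M
--     to the vertices of a largest clique (of size ω(G) = k > M²) it yields
--     a rainbow or a monochromatic K_n, so no colouring is a K_n-WORM
--     colouring. This direction only uses that G contains K_k.
-- (⇐) Take a proper colouring c with colours below k ≤ M² and recolour each
--     vertex v by ⌊c(v)/M⌋. Among the M+1 vertices of a K_n two share
--     c mod M; were the K_n monochromatic they would share c as well,
--     contradicting properness. The new colours lie below M, so two
--     vertices of the K_n share one and it is not rainbow. This direction
--     only uses that χ(G) ≤ k.

open import Defs
open import Data.Nat using (ℕ; _≤_; _∸_; _*_)
open import Function.Bundles using (_⇔_; mk⇔)

open import Function.Base using (_∘_)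
open import Data.Nat using (zero; suc; _+_; _<_; _/_; _%_; NonZero; s≤s; s≤s⁻¹; _≤?_; _≟_)
open import Data.Nat.Properties using (+-suc; ≮⇒≥; ≰⇒>; m≤n⇒m⊓n≡m; <-≤-trans; +-monoˡ-<; +-cancelˡ-<; n<1+n; module ≤-Reasoning)
open import Data.Nat.DivMod using (m≡m%n+[m/n]*n; m%n<n; m<n*o⇒m/o<n)
open import Data.Fin using (Fin; zero; suc; toℕ; fromℕ<)
open import Data.Fin.Properties using (pigeonhole; toℕ-injective; toℕ<n; fromℕ<-injective; <⇒≢)
open import Data.List using (List; []; _∷_; length; lookup; take; filter; allFin)
open import Data.List.Properties using (length-take; length-tabulate)
open import Data.List.Membership.Propositional.Properties using (∈-lookup)
open import Data.List.Relation.Unary.All as All using (All; []; _∷_)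
open import Data.List.Relation.Unary.All.Properties using (all-filter) renaming (take⁺ to All-take⁺)
open import Data.List.Relation.Unary.AllPairs using (AllPairs; []; _∷_)
open import Data.List.Relation.Unary.Unique.Propositional using (Unique)
open import Data.List.Relation.Unary.Unique.Propositional.Properties using (allFin⁺)
open import Data.List.Relation.Binary.Sublist.Propositional using (_⊆_; []; _∷_; _∷ʳ_; minimum; ⊆-trans)
open import Data.List.Relation.Binary.Sublist.Propositional.Properties using (All-resp-⊆; filter-⊆; take-⊆)
open import Data.Product using (∃; ∃₂; _×_; _,_; proj₁; proj₂)
open import Data.Sum using (_⊎_; inj₁; inj₂; [_,_])
open import Data.Empty using (⊥-elim)
open import Relation.Nullary using (¬_; yes; no)
open import Relation.Unary using (Decidable)
open import Relation.Unary.Properties using (∁?)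
open import Relation.Binary.PropositionalEquality using (_≡_; _≢_; refl; trans; cong; cong₂; subst; module ≡-Reasoning) renaming (sym to ≡-sym)

AllPairs-resp-⊆ : ∀ {A : Set} {R : A → A → Set} {xs ys : List A} →
  ys ⊆ xs → AllPairs R xs → AllPairs R ys
AllPairs-resp-⊆ []         []         = []
AllPairs-resp-⊆ (_ ∷ʳ τ)   (_ ∷ rxs)  = AllPairs-resp-⊆ τ rxs
AllPairs-resp-⊆ (refl ∷ τ) (rx ∷ rxs) = All-resp-⊆ τ rx ∷ AllPairs-resp-⊆ τ rxs

length-filter-∁ : ∀ {A : Set} {P : A → Set} (P? : Decidable P) (xs : List A) →
  length (filter P? xs) + length (filter (∁? P?) xs) ≡ length xs
length-filter-∁ P? [] = refl
length-filter-∁ P? (x ∷ xs) with P? x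
... | yes _ = cong suc (length-filter-∁ P? xs)
... | no  _ = trans (+-suc _ _) (cong suc (length-filter-∁ P? xs))

lookup-separated : ∀ {A B : Set} (g : A → B) {xs : List A} →
  AllPairs (λ a b → g a ≢ g b) xs →
  ∀ i j → g (lookup xs i) ≡ g (lookup xs j) → i ≡ j
lookup-separated g (_  ∷ _)  zero    zero    _ = refl
lookup-separated g (gx ∷ _)  zero    (suc j) e = ⊥-elim (All.lookup gx (∈-lookup j) e)
lookup-separated g (gx ∷ _)  (suc i) zero    e = ⊥-elim (All.lookup gx (∈-lookup i) (≡-sym e))
lookup-separated g (_  ∷ gs) (suc i) (suc j) e = cong suc (lookup-separated g gs i j e)

module Selections {A : Set} (f : A → ℕ) where

  record Selection (Good : List A → Set) (r : ℕ) (xs : List A) : Set where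
    field
      members : List A
      size    : length members ≡ r
      sublist : members ⊆ xs
      good    : Good members
  open Selection public

  DistinctColours : List A → Set
  DistinctColours = AllPairs (λ a b → f a ≢ f b)

  OneColour : List A → Set
  OneColour ys = ∃ λ c → All (λ a → f a ≡ c) ys

  sameAs? : (x : A) → Decidable (λ y → f y ≡ f x)
  sameAs? x y = f y ≟ f x

  classOf othersOf : A → List A → List A
  classOf  x = filter (sameAs? x)
  othersOf x = filter (∁? (sameAs? x))

  length-class+others : ∀ x xs → length (classOf x xs) + length (othersOf x xs) ≡ length xs
  length-class+others x = length-filter-∁ (sameAs? x)

  widen : ∀ {Good r xs ys} → xs ⊆ ys → Selection Good r xs → Selection Good r ys
  widen τ s = record
    { members = members s ; size = size s ; sublist = ⊆-trans (sublist s) τ ; good = good s }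

  -- Induction on m, splitting off
  -- the head x: either x together with b objects of its colour class is
  -- monochromatic, or more than (m-1)·b objects have other colours and x
  -- extends a rainbow selection among them.
  distinct-or-one-colour : ∀ m b xs → m * b < length xs →
    Selection DistinctColours (suc m) xs ⊎ Selection OneColour (suc b) xs
  distinct-or-one-colour zero b (x ∷ xs) _ = inj₁ record
    { members = x ∷ [] ; size = refl ; sublist = refl ∷ minimum xs ; good = [] ∷ [] }
  distinct-or-one-colour (suc m) b (x ∷ xs) large with b ≤? length (classOf x xs)
  ... | yes class-large = inj₂ record
    { members = x ∷ take b class
    ; size    = cong suc (trans (length-take b class) (m≤n⇒m⊓n≡m class-large))
    ; sublist = refl ∷ ⊆-trans (take-⊆ b class) (filter-⊆ (sameAs? x) xs)
    ; good    = f x , refl ∷ All-take⁺ b (all-filter (sameAs? x) xs) }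
    where class = classOf x xs
  ... | no class-small = extend (distinct-or-one-colour m b others others-large)
    where
    others : List A
    others = othersOf x xs

    others-large : m * b < length others
    others-large = +-cancelˡ-< b (m * b) (length others) (begin-strict
      b + m * b                             ≤⟨ s≤s⁻¹ large ⟩
      length xs                             ≡⟨ ≡-sym (length-class+others x xs) ⟩
      length (classOf x xs) + length others <⟨ +-monoˡ-< (length others) (≰⇒> class-small) ⟩
      b + length others                     ∎)
      where open ≤-Reasoning

    others-⊆ : others ⊆ xs
    others-⊆ = filter-⊆ (∁? (sameAs? x)) xs

    head-apart : ∀ {ys} → ys ⊆ others → All (λ y → f x ≢ f y) ys
    head-apart τ = All.map (λ fy≢fx fx≡fy → fy≢fx (≡-sym fx≡fy))
                           (All-resp-⊆ τ (all-filter (∁? (sameAs? x)) xs))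

    extend : Selection DistinctColours (suc m) others ⊎ Selection OneColour (suc b) others →
      Selection DistinctColours (suc (suc m)) (x ∷ xs) ⊎ Selection OneColour (suc b) (x ∷ xs)
    extend (inj₁ s) = inj₁ record
      { members = x ∷ members s
      ; size    = cong suc (size s)
      ; sublist = refl ∷ ⊆-trans (sublist s) others-⊆
      ; good    = head-apart (sublist s) ∷ good s }
    extend (inj₂ s) = inj₂ (widen (x ∷ʳ others-⊆) s)

restrict : ∀ {V k r} {G : Graph V} → Clique G k →
  (σ : Fin r → Fin k) → (∀ i j → σ i ≡ σ j → i ≡ j) → Clique G r
restrict K σ σ-inj = record
  { vert = vert K ∘ σ
  ; inj  = λ i j e → σ-inj i j (inj K _ _ e)
  ; adj  = λ i j i≢j → adj K _ _ (λ e → i≢j (σ-inj i j e)) }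

listClique : ∀ {V k} {G : Graph V} → Clique G k → (ys : List (Fin k)) → Unique ys →
  Clique G (length ys)
listClique K ys unique = restrict K (lookup ys) (lookup-separated (λ y → y) unique)

rainbow-obstruction : ∀ {V k} {G : Graph V} (w : Fin V → ℕ) (K : Clique G k)
  (ys : List (Fin k)) (unique : Unique ys) →
  AllPairs (λ a b → w (vert K a) ≢ w (vert K b)) ys → ¬ IsKnWORMColoring (length ys) G w
rainbow-obstruction w K ys unique distinct worm =
  proj₂ (worm (listClique K ys unique)) (lookup-separated (w ∘ vert K) distinct)

monochromatic-obstruction : ∀ {V k} {G : Graph V} (w : Fin V → ℕ) (K : Clique G k)
  (ys : List (Fin k)) (unique : Unique ys) (c : ℕ) →
  All (λ a → w (vert K a) ≡ c) ys → ¬ IsKnWORMColoring (length ys) G w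
monochromatic-obstruction w K ys unique c uniform worm =
  proj₁ (worm (listClique K ys unique))
    (λ i j → trans (All.lookup uniform (∈-lookup i)) (≡-sym (All.lookup uniform (∈-lookup j))))

-- (⇒) If G has a K_{m+1}-WORM colouring then every clique of G has at most
-- m² vertices: otherwise the selection lemma, applied to the colours of the
-- clique's vertices, produces a rainbow or a monochromatic K_{m+1}.
worm⇒clique-bound : ∀ {V k} {G : Graph V} m → KnWORMColorable (suc m) G → Clique G k → k ≤ m * m
worm⇒clique-bound {k = k} {G} m (w , worm) K = ≮⇒≥ λ big →
  [ (λ s → rainbow-obstruction w K (members s) (unique s) (good s) (worm-of s))
  , (λ s → monochromatic-obstruction w K (members s) (unique s) (proj₁ (good s)) (proj₂ (good s)) (worm-of s))
  ] (distinct-or-one-colour m m (allFin k) (subst (m * m <_) (≡-sym (length-tabulate (λ i → i))) big))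
  where
  open Selections (w ∘ vert K)

  unique : ∀ {Good r} → (s : Selection Good r (allFin k)) → Unique (members s)
  unique s = AllPairs-resp-⊆ (sublist s) (allFin⁺ k)

  worm-of : ∀ {Good} → (s : Selection Good (suc m) (allFin k)) → IsKnWORMColoring (length (members s)) G w
  worm-of s = subst (λ r → IsKnWORMColoring r G w) (≡-sym (size s)) worm

divMod-injective : ∀ M .{{_ : NonZero M}} {a b : ℕ} → a % M ≡ b % M → a / M ≡ b / M → a ≡ b
divMod-injective M {a} {b} same-rem same-quot = begin
  a                 ≡⟨ m≡m%n+[m/n]*n a M ⟩
  a % M + a / M * M ≡⟨ cong₂ (λ r q → r + q * M) same-rem same-quot ⟩
  b % M + b / M * M ≡⟨ ≡-sym (m≡m%n+[m/n]*n b M) ⟩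
  b                 ∎
  where open ≡-Reasoning

collision : ∀ {M} (g : Fin (suc M) → ℕ) → (∀ i → g i < M) → ∃₂ λ i j → i ≢ j × g i ≡ g j
collision {M} g bounded with pigeonhole (n<1+n M) (λ i → fromℕ< (bounded i))
... | i , j , i<j , same = i , j , <⇒≢ i<j , fromℕ<-injective (g i) (g j) (bounded i) (bounded j) same

proper⇒worm : ∀ {V k} {G : Graph V} M .{{_ : NonZero M}} →
  ProperColoring G k → k ≤ M * M → KnWORMColorable (suc M) G
proper⇒worm {V} M (c , proper) k≤M² = w , λ L → not-monochromatic L , not-rainbow L
  where
  colour : Fin V → ℕ
  colour v = toℕ (c v)

  w : Fin V → ℕ
  w v = colour v / M

  -- Two vertices of L agree in c mod M; if they also agreed in w they
  -- would have the same c-colour although adjacent.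
  not-monochromatic : ∀ L → ¬ Monochromatic w L
  not-monochromatic L mono with collision (λ i → colour (vert L i) % M) (λ i → m%n<n _ M)
  ... | i , j , i≢j , same-rem =
    proper _ _ (adj L i j i≢j) (toℕ-injective (divMod-injective M same-rem (mono i j)))

  -- The colours of w are below M, so two vertices of L share one.
  not-rainbow : ∀ L → ¬ Rainbow w L
  not-rainbow L rainbow
    with collision (λ i → w (vert L i)) (λ i → m<n*o⇒m/o<n (<-≤-trans (toℕ<n (c (vert L i))) k≤M²))
  ... | i , j , i≢j , same = i≢j (rainbow i j same)

proposition8 : (n : ℕ) → 3 ≤ n → (V : ℕ) → (G : Graph V) → (k : ℕ) → IsChromaticNumber G k → IsCliqueNumber G k → KnWORMColorable n G ⇔ (k ≤ (n ∸ 1) * (n ∸ 1))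
proposition8 (suc M) (s≤s (s≤s (s≤s _))) V G k (proper , _) (clique , _) =
  mk⇔ (λ worm → worm⇒clique-bound M worm clique) (proper⇒worm M proper)
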